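{- $\mathrm{GL}_4(\mathbb{F}_3)$ does not contain a subgroup isomorphic to $A_5\times V_4$.
   Context: $V_4$ denotes the Klein four-group $C_2\times C_2$. -}

module Defs where

open import Data.Nat using (ℕ; zero; suc; _<ᵇ_)
open import Data.Nat.DivMod using (_%_)
open import Data.Bool using (Bool; true; false; if_then_else_; _xor_; _∧_)
open import Data.Fin using (Fin; toℕ)
open import Data.Vec using (Vec; lookup; tabulate; map; foldr)
open import Data.List using (List; concatMap)
import Data.Nat.ListAction
open import Data.List using (allFin) renaming (map to mapL)
open import Data.Product using (Σ; _×_)
open import Relation.Binary.PropositionalEquality using (_≡_)
open import Relation.Nullary.Decidable using (does)

data F3 : Set where
  f0 f1 f2 : F3

_+F_ : F3 → F3 → F3
f0 +F y = y
f1 +F f0 = f1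
f1 +F f1 = f2
f1 +F f2 = f0
f2 +F f0 = f2
f2 +F f1 = f0
f2 +F f2 = f1

_*F_ : F3 → F3 → F3
f0 *F y = f0
f1 *F y = y
f2 *F f0 = f0
f2 *F f1 = f2
f2 *F f2 = f1

Mat : Set
Mat = Vec (Vec F3 4) 4

entry : Mat → Fin 4 → Fin 4 → F3
entry M i j = lookup (lookup M i) j

sumF : {n : ℕ} → Vec F3 n → F3
sumF = foldr _ _+F_ f0

_·_ : Mat → Mat → Mat
M · N = tabulate λ i → tabulate λ j → sumF (tabulate λ k → entry M i k *F entry N k j)

idMat : Mat
idMat = tabulate λ i → tabulate λ j →
  if does (Data.Fin._≟_ i j) then f1 else f0

Invertible : Mat → Set
Invertible M = Σ Mat λ N → (M · N ≡ idMat) × (N · M ≡ idMat)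

Perm5 : Set
Perm5 = Vec (Fin 5) 5

IsPerm : Perm5 → Set
IsPerm σ = ∀ i j → lookup σ i ≡ lookup σ j → i ≡ j

_∘p_ : Perm5 → Perm5 → Perm5
σ ∘p τ = map (lookup σ) τ

inversions : Perm5 → ℕ
inversions σ = Data.Nat.ListAction.sum (concatMap (λ i → mapL (λ j →
  if (toℕ i <ᵇ toℕ j) ∧ (toℕ (lookup σ j) <ᵇ toℕ (lookup σ i)) then 1 else 0)
  (allFin 5)) (allFin 5))

IsEven : Perm5 → Set
IsEven σ = inversions σ % 2 ≡ 0

InA5 : Perm5 → Set
InA5 σ = IsPerm σ × IsEven σ

-- The group A₅ × V₄, with V₄ = C₂ × C₂ written additively as Bool × Bool (xor).
-- An element is (σ , a , b); product (σ,a,b)(τ,c,d) = (σ∘τ, a xor c, b xor d).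

record EmbedsA5×V4 : Set where
  field
    φ      : Perm5 → Bool → Bool → Mat
    inGL   : ∀ σ a b → InA5 σ → Invertible (φ σ a b)
    hom    : ∀ σ τ a b c d → InA5 σ → InA5 τ →
             φ (σ ∘p τ) (a xor c) (b xor d) ≡ φ σ a b · φ τ c d
    inj    : ∀ σ τ a b c d → InA5 σ → InA5 τ →
             φ σ a b ≡ φ τ c d → (σ ≡ τ) × (a ≡ c) × (b ≡ d)

-- Let g be the image of a 5-cycle and z that of a non-trivial element of V₄, both acting on
-- F₃⁴. Since t⁵ − 1 = (t − 1)Φ₅ and Φ₅ = 1 + t + t² + t³ + t⁴ is irreducible over F₃, every
-- vector y = gx − x ≠ 0 generates a copy of the field F₃[t]/(Φ₅) ≅ F₈₁, so that
-- y, gy, g²y, g³y are linearly independent. The involution z commutes with g, so g preserves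
-- both eigenspaces of z. If z ≠ ±1, both are non-zero, and an eigenspace containing such a y
-- would carry four independent vectors besides a non-zero vector of the other eigenspace:
-- five independent vectors in F₃⁴. Hence g fixes both eigenspaces pointwise, i.e. g = 1,
-- contradicting injectivity. So all three non-trivial elements of V₄ map to −1, which
-- contradicts injectivity once more.

module Submission where

open import Defs

open import Algebra.Bundles using (CommutativeRing)
open import Algebra.Consequences.Propositional using (comm∧distrˡ⇒distrʳ)
open import Algebra.Core using (Op₁; Op₂)
open import Algebra.Structures using (IsCommutativeRing)
open import Data.Bool using (Bool; true; false; _xor_)
open import Data.Bool.Properties using (xor-same; xor-identityʳ)
open import Data.Fin as Fin using (Fin; zero; suc)
open import Data.Fin.Properties using (injective⇒≤; ¬∀⟶∃¬; all?)
open import Data.List using (List; _∷_; []; cartesianProductWith)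
open import Data.List.Membership.Propositional using (_∈_)
open import Data.List.Membership.Propositional.Properties using (∈-cartesianProductWith⁺)
open import Data.List.Relation.Unary.All as All using (All)
open import Data.List.Relation.Unary.Any as Any using (Any; here; there)
open import Data.Nat as ℕ using (ℕ; _^_; _≤_; s≤s; z≤n)
open import Data.Nat.DivMod using (_%_)
import Data.Nat.Properties as ℕ
open import Data.Product as Product using (_,_; _×_; ∃; proj₁; proj₂)
open import Data.Sum using (_⊎_; inj₁; inj₂; [_,_]′)
open import Data.Vec using (Vec; _∷_; []; zipWith; map; replicate; lookup; tabulate; iterate; _∷ʳ_; allFin)
open import Data.Vec.Properties
  using ( zipWith-assoc; zipWith-comm; zipWith-identityˡ; zipWith-identityʳ; zipWith-inverseˡ
        ; zipWith-inverseʳ; zipWith-distribˡ; zipWith-distribʳ; ≡-dec; lookup-replicate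
        ; lookup-zipWith; lookup∘tabulate; tabulate∘lookup; tabulate-cong; tabulate-∘ )
open import Data.Vec.Recursive using (lift↔; Fin[m^n]↔Fin[m]^n)
open import Data.Vec.Recursive.Properties using (↔Vec)
open import Data.Vec.Relation.Binary.Pointwise.Extensional using (ext; Pointwise-≡⇒≡)
open import Function using (_∘_; id; flip; _↔_; Injective; Inverse; Injection; mk↔ₛ′)
import Function.Construct.Composition as Comp
open import Function.Properties.Inverse using (↔-sym; ↔-trans; ↔⇒↣)
open import Level using (0ℓ)
open import Relation.Binary.Definitions using (DecidableEquality)
open import Relation.Binary.PropositionalEquality as ≡
  using (_≡_; _≢_; refl; sym; trans; cong; cong₂; module ≡-Reasoning)
open import Relation.Nullary using (Dec; yes; no; ¬_)
open import Relation.Nullary.Decidable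
  using (toWitness; from-yes; decidable-stable; dec⇒maybe; _⊎-dec_; _×-dec_; _→-dec_)
open import Relation.Nullary.Negation using (contradiction)
open import Tactic.RingSolver using (solve-∀)
open import Tactic.RingSolver.Core.AlmostCommutativeRing using (AlmostCommutativeRing; fromCommutativeRing)

-- The field F₃

-F_ : F3 → F3
-F f0 = f0
-F f1 = f2
-F f2 = f1

+F-assoc : ∀ x y z → (x +F y) +F z ≡ x +F (y +F z)
+F-assoc f0 y  z  = refl
+F-assoc f1 f0 z  = refl
+F-assoc f1 f1 f0 = refl
+F-assoc f1 f1 f1 = refl
+F-assoc f1 f1 f2 = refl
+F-assoc f1 f2 f0 = refl
+F-assoc f1 f2 f1 = refl
+F-assoc f1 f2 f2 = refl
+F-assoc f2 f0 z  = refl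
+F-assoc f2 f1 f0 = refl
+F-assoc f2 f1 f1 = refl
+F-assoc f2 f1 f2 = refl
+F-assoc f2 f2 f0 = refl
+F-assoc f2 f2 f1 = refl
+F-assoc f2 f2 f2 = refl

+F-identityʳ : ∀ x → x +F f0 ≡ x
+F-identityʳ f0 = refl
+F-identityʳ f1 = refl
+F-identityʳ f2 = refl

+F-comm : ∀ x y → x +F y ≡ y +F x
+F-comm f0 y  = sym (+F-identityʳ y)
+F-comm f1 f0 = refl
+F-comm f1 f1 = refl
+F-comm f1 f2 = refl
+F-comm f2 f0 = refl
+F-comm f2 f1 = refl
+F-comm f2 f2 = refl

-F‿inverseˡ : ∀ x → (-F x) +F x ≡ f0
-F‿inverseˡ f0 = refl
-F‿inverseˡ f1 = refl
-F‿inverseˡ f2 = refl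

-F‿inverseʳ : ∀ x → x +F (-F x) ≡ f0
-F‿inverseʳ f0 = refl
-F‿inverseʳ f1 = refl
-F‿inverseʳ f2 = refl

*F-assoc : ∀ x y z → (x *F y) *F z ≡ x *F (y *F z)
*F-assoc f0 y  z  = refl
*F-assoc f1 y  z  = refl
*F-assoc f2 f0 z  = refl
*F-assoc f2 f1 z  = refl
*F-assoc f2 f2 f0 = refl
*F-assoc f2 f2 f1 = refl
*F-assoc f2 f2 f2 = refl

*F-identityʳ : ∀ x → x *F f1 ≡ x
*F-identityʳ f0 = refl
*F-identityʳ f1 = refl
*F-identityʳ f2 = refl

*F-zeroʳ : ∀ x → x *F f0 ≡ f0
*F-zeroʳ f0 = refl
*F-zeroʳ f1 = refl
*F-zeroʳ f2 = refl

*F-comm : ∀ x y → x *F y ≡ y *F x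
*F-comm f0 y  = sym (*F-zeroʳ y)
*F-comm f1 y  = sym (*F-identityʳ y)
*F-comm f2 f0 = refl
*F-comm f2 f1 = refl
*F-comm f2 f2 = refl

*F-distribˡ : ∀ x y z → x *F (y +F z) ≡ (x *F y) +F (x *F z)
*F-distribˡ f0 y  z  = refl
*F-distribˡ f1 y  z  = refl
*F-distribˡ f2 f0 z  = refl
*F-distribˡ f2 f1 f0 = refl
*F-distribˡ f2 f1 f1 = refl
*F-distribˡ f2 f1 f2 = refl
*F-distribˡ f2 f2 f0 = refl
*F-distribˡ f2 f2 f1 = refl
*F-distribˡ f2 f2 f2 = refl

F3-isCommutativeRing : IsCommutativeRing _≡_ _+F_ _*F_ -F_ f0 f1
F3-isCommutativeRing = record
  { isRing = record
    { +-isAbelianGroup = record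
      { isGroup = record
        { isMonoid = record
          { isSemigroup = record
            { isMagma = record { isEquivalence = ≡.isEquivalence ; ∙-cong = cong₂ _+F_ }
            ; assoc = +F-assoc }
          ; identity = (λ _ → refl) , +F-identityʳ }
        ; inverse = -F‿inverseˡ , -F‿inverseʳ
        ; ⁻¹-cong = cong -F_ }
      ; comm = +F-comm }
    ; *-cong = cong₂ _*F_
    ; *-assoc = *F-assoc
    ; *-identity = (λ _ → refl) , *F-identityʳ
    ; distrib = *F-distribˡ , comm∧distrˡ⇒distrʳ *F-comm *F-distribˡ }
  ; *-comm = *F-comm }

_≟F_ : DecidableEquality F3
f0 ≟F f0 = yes refl
f0 ≟F f1 = no λ ()
f0 ≟F f2 = no λ ()
f1 ≟F f0 = no λ ()
f1 ≟F f1 = yes refl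
f1 ≟F f2 = no λ ()
f2 ≟F f0 = no λ ()
f2 ≟F f1 = no λ ()
f2 ≟F f2 = yes refl

-- The vector space F₃⁴

module _ {A : Set} {_+_ _*_ : Op₂ A} { -_ : Op₁ A} {0# 1# : A}
         (isCommutativeRing : IsCommutativeRing _≡_ _+_ _*_ -_ 0# 1#) where
  open IsCommutativeRing isCommutativeRing hiding (_-_)

  zipWith-isCommutativeRing : ∀ n → IsCommutativeRing _≡_ (zipWith {n = n} _+_) (zipWith _*_) (map -_)
                                                        (replicate n 0#) (replicate n 1#)
  zipWith-isCommutativeRing n = record
    { isRing = record
      { +-isAbelianGroup = record
        { isGroup = record
          { isMonoid = record
            { isSemigroup = record
              { isMagma = record { isEquivalence = ≡.isEquivalence ; ∙-cong = cong₂ _ }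
              ; assoc = zipWith-assoc +-assoc }
            ; identity = zipWith-identityˡ +-identityˡ , zipWith-identityʳ +-identityʳ }
          ; inverse = zipWith-inverseˡ -‿inverseˡ , zipWith-inverseʳ -‿inverseʳ
          ; ⁻¹-cong = cong (map -_) }
        ; comm = zipWith-comm +-comm }
      ; *-cong = cong₂ _
      ; *-assoc = zipWith-assoc *-assoc
      ; *-identity = zipWith-identityˡ *-identityˡ , zipWith-identityʳ *-identityʳ
      ; distrib = zipWith-distribˡ distribˡ , zipWith-distribʳ distribʳ }
    ; *-comm = zipWith-comm *-comm }

F3^-commutativeRing : ℕ → CommutativeRing 0ℓ 0ℓ
F3^-commutativeRing n = record { isCommutativeRing = zipWith-isCommutativeRing F3-isCommutativeRing n }

V : Set
V = Vec F3 4

-- F₃⁴ carries the componentwise ring structure only so that the ring solver can normalise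
-- vector identities; scalars act through the diagonal, c ⊙ v = (c, c, c, c) * v. The zero test
-- passed to the solver lets it evaluate closed coefficients, so it also knows that 3 = 0.
V-ring : AlmostCommutativeRing 0ℓ 0ℓ
V-ring = fromCommutativeRing (F3^-commutativeRing 4) λ x → dec⇒maybe (≡-dec _≟F_ (replicate 4 f0) x)

open AlmostCommutativeRing V-ring using (_+_; _*_; -_; _-_; 0#; 1#)

infixr 8 _⊙_
_⊙_ : F3 → V → V
c ⊙ v = replicate 4 c * v

infix 4 _≟V_
_≟V_ : DecidableEquality V
_≟V_ = ≡-dec _≟F_

module _ {m : ℕ} where
  open import Algebra.Properties.Group (CommutativeRing.+-group (F3^-commutativeRing m)) public
    using () renaming (x∙y⁻¹≈ε⇒x≈y to a-b≡0⇒a≡b)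

c⊙w≡0⇒c≡0⊎w≡0 : ∀ c w → c ⊙ w ≡ 0# → c ≡ f0 ⊎ w ≡ 0#
c⊙w≡0⇒c≡0⊎w≡0 f0 w _ = inj₁ refl
c⊙w≡0⇒c≡0⊎w≡0 f1 w h = inj₂ (trans (sym (*-identityˡ w)) h)
  where
  *-identityˡ : ∀ w → 1# * w ≡ w
  *-identityˡ = solve-∀ V-ring
c⊙w≡0⇒c≡0⊎w≡0 f2 w h = inj₂ (trans (involutive w) (cong (f2 ⊙_) h))
  where
  involutive : ∀ w → w ≡ (- 1#) * ((- 1#) * w)
  involutive = solve-∀ V-ring

lincomb : ∀ {m} → Vec F3 m → Vec V m → V
lincomb []       []       = 0#
lincomb (c ∷ cs) (v ∷ vs) = c ⊙ v + lincomb cs vs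

e : ∀ {m} → Fin m → Vec F3 m
e zero    = f1 ∷ replicate _ f0
e (suc j) = f0 ∷ e j

lincomb-+ : ∀ {m} (a b : Vec F3 m) vs → lincomb (zipWith _+F_ a b) vs ≡ lincomb a vs + lincomb b vs
lincomb-+ []       []       []       = solve-∀ V-ring
lincomb-+ (a ∷ as) (b ∷ bs) (v ∷ vs) =
  trans (cong ((a +F b) ⊙ v +_) (lincomb-+ as bs vs)) (rearrange _ _ v _ _)
  where
  rearrange : ∀ A B v X Y → (A + B) * v + (X + Y) ≡ (A * v + X) + (B * v + Y)
  rearrange = solve-∀ V-ring

lincomb-⊙ : ∀ {m} c (a : Vec F3 m) vs → lincomb (zipWith _*F_ (replicate m c) a) vs ≡ c ⊙ lincomb a vs
lincomb-⊙ c []       []       = vanish _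
  where
  vanish : ∀ C → 0# ≡ C * 0#
  vanish = solve-∀ V-ring
lincomb-⊙ c (a ∷ as) (v ∷ vs) =
  trans (cong ((c *F a) ⊙ v +_) (lincomb-⊙ c as vs)) (rearrange _ _ v _)
  where
  rearrange : ∀ C A v X → (C * A) * v + C * X ≡ C * (A * v + X)
  rearrange = solve-∀ V-ring

lincomb-− : ∀ {m} (a b : Vec F3 m) vs → lincomb (zipWith _+F_ a (map -F_ b)) vs ≡ lincomb a vs - lincomb b vs
lincomb-− []       []       []       = solve-∀ V-ring
lincomb-− (a ∷ as) (b ∷ bs) (v ∷ vs) =
  trans (cong ((a +F (-F b)) ⊙ v +_) (lincomb-− as bs vs)) (rearrange _ _ v _ _)
  where
  rearrange : ∀ A B v X Y → (A - B) * v + (X - Y) ≡ (A * v + X) - (B * v + Y)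
  rearrange = solve-∀ V-ring

lincomb-neg : ∀ {m} (a : Vec F3 m) vs → lincomb a (map -_ vs) ≡ - lincomb a vs
lincomb-neg []       []       = solve-∀ V-ring
lincomb-neg (a ∷ as) (v ∷ vs) = trans (cong (a ⊙ (- v) +_) (lincomb-neg as vs)) (rearrange _ v _)
  where
  rearrange : ∀ A v X → A * (- v) + (- X) ≡ - (A * v + X)
  rearrange = solve-∀ V-ring

lincomb-zeroˡ : ∀ {m} (vs : Vec V m) → lincomb (replicate m f0) vs ≡ 0#
lincomb-zeroˡ []       = refl
lincomb-zeroˡ (v ∷ vs) = trans (cong (f0 ⊙ v +_) (lincomb-zeroˡ vs)) (vanish v)
  where
  vanish : ∀ v → 0# * v + 0# ≡ 0#
  vanish = solve-∀ V-ring

lincomb-zeroʳ : ∀ {m} (a : Vec F3 m) → lincomb a (replicate m 0#) ≡ 0#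
lincomb-zeroʳ []       = refl
lincomb-zeroʳ (a ∷ as) = trans (cong (a ⊙ 0# +_) (lincomb-zeroʳ as)) (vanish _)
  where
  vanish : ∀ A → A * 0# + 0# ≡ 0#
  vanish = solve-∀ V-ring

lincomb-e : ∀ {m} (j : Fin m) vs → lincomb (e j) vs ≡ lookup vs j
lincomb-e zero    (v ∷ vs) = trans (cong (f1 ⊙ v +_) (lincomb-zeroˡ vs)) (unit v)
  where
  unit : ∀ v → 1# * v + 0# ≡ v
  unit = solve-∀ V-ring
lincomb-e (suc j) (v ∷ vs) = trans (cong (f0 ⊙ v +_) (lincomb-e j vs)) (unit v _)
  where
  unit : ∀ v x → 0# * v + x ≡ x
  unit = solve-∀ V-ring

lincomb-∷ʳ : ∀ {m} (a : Vec F3 m) c vs w → lincomb (a ∷ʳ c) (vs ∷ʳ w) ≡ lincomb a vs + c ⊙ w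
lincomb-∷ʳ []       c []       w = swap (replicate 4 c) w
  where
  swap : ∀ C w → C * w + 0# ≡ 0# + C * w
  swap = solve-∀ V-ring
lincomb-∷ʳ (a ∷ as) c (v ∷ vs) w = trans (cong (a ⊙ v +_) (lincomb-∷ʳ as c vs w)) (+-assoc _ _ _)
  where
  +-assoc : ∀ x y z → x + (y + z) ≡ (x + y) + z
  +-assoc = solve-∀ V-ring

record IsLinear (f : V → V) : Set where
  field
    +-homo : ∀ u v → f (u + v) ≡ f u + f v
    ⊙-homo : ∀ c v → f (c ⊙ v) ≡ c ⊙ f v

  0#-homo : f 0# ≡ 0#
  0#-homo = trans (⊙-homo f0 0#) (vanish (f 0#))
    where
    vanish : ∀ x → 0# * x ≡ 0#
    vanish = solve-∀ V-ring

  -‿homo : ∀ v → f (- v) ≡ - f v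
  -‿homo v = trans (cong f (neg-as-⊙ v)) (trans (⊙-homo f2 v) (sym (neg-as-⊙ (f v))))
    where
    neg-as-⊙ : ∀ x → - x ≡ (- 1#) * x
    neg-as-⊙ = solve-∀ V-ring

  −-homo : ∀ u v → f (u - v) ≡ f u - f v
  −-homo u v = trans (+-homo u (- v)) (cong (f u +_) (-‿homo v))

  lincomb-homo : ∀ {m} (a : Vec F3 m) vs → f (lincomb a vs) ≡ lincomb a (map f vs)
  lincomb-homo []       []       = 0#-homo
  lincomb-homo (a ∷ as) (v ∷ vs) = trans (+-homo _ _) (cong₂ _+_ (⊙-homo a v) (lincomb-homo as vs))

lincomb-isLinear : (vs : Vec V 4) → IsLinear (λ a → lincomb a vs)
lincomb-isLinear vs = record
  { +-homo = λ u v → lincomb-+ u v vs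
  ; ⊙-homo = λ c v → lincomb-⊙ c v vs
  }

-‿isLinear : ∀ {f} → IsLinear f → IsLinear (λ v → - f v)
-‿isLinear {f} f-linear = record
  { +-homo = λ u v → trans (cong -_ (+-homo u v)) (-‿distrib (f u) (f v))
  ; ⊙-homo = λ c v → trans (cong -_ (⊙-homo c v)) (-‿*-comm (replicate 4 c) (f v))
  }
  where
  open IsLinear f-linear
  -‿distrib : ∀ x y → - (x + y) ≡ - x + - y
  -‿distrib = solve-∀ V-ring
  -‿*-comm : ∀ C x → - (C * x) ≡ C * (- x)
  -‿*-comm = solve-∀ V-ring

F3↔Fin3 : F3 ↔ Fin 3
F3↔Fin3 = mk↔ₛ′ to from to∘from from∘to
  where
  to : F3 → Fin 3
  to f0 = zero
  to f1 = suc zero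
  to f2 = suc (suc zero)
  from : Fin 3 → F3
  from zero             = f0
  from (suc zero)       = f1
  from (suc (suc zero)) = f2
  to∘from : ∀ i → to (from i) ≡ i
  to∘from zero             = refl
  to∘from (suc zero)       = refl
  to∘from (suc (suc zero)) = refl
  from∘to : ∀ x → from (to x) ≡ x
  from∘to f0 = refl
  from∘to f1 = refl
  from∘to f2 = refl

F3^↔Fin : ∀ n → Vec F3 n ↔ Fin (3 ^ n)
F3^↔Fin n = ↔-trans (↔-sym (↔Vec n)) (↔-trans (lift↔ n F3↔Fin3) (↔-sym (Fin[m^n]↔Fin[m]^n 3 n)))

injective⇒length≤ : ∀ {m n} (f : Vec F3 m → Vec F3 n) → Injective _≡_ _≡_ f → m ≤ n
injective⇒length≤ {m} {n} f f-injective = ℕ.≮⇒≥ λ n<m →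
  ℕ.<⇒≱ (ℕ.^-monoʳ-< 3 (s≤s (s≤s z≤n)) n<m) (injective⇒≤ counting)
  where
  counting : Injective _≡_ _≡_ (Inverse.to (F3^↔Fin n) ∘ f ∘ Inverse.from (F3^↔Fin m))
  counting = Comp.injective _≡_ _≡_ _≡_
    (Injection.injective (↔⇒↣ (↔-sym (F3^↔Fin m))))
    (Comp.injective _≡_ _≡_ _≡_ f-injective (Injection.injective (↔⇒↣ (F3^↔Fin n))))

LinearlyIndependent : ∀ {m} → Vec V m → Set
LinearlyIndependent {m} vs = ∀ a → lincomb a vs ≡ 0# → a ≡ replicate m f0

independent⇒length≤4 : ∀ {m} {vs : Vec V m} → LinearlyIndependent vs → m ≤ 4
independent⇒length≤4 {m} {vs} independent = injective⇒length≤ (λ a → lincomb a vs) injective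
  where
  cancel : ∀ x → x - x ≡ 0#
  cancel = solve-∀ V-ring
  injective : Injective _≡_ _≡_ (λ a → lincomb a vs)
  injective {a} {b} eq = a-b≡0⇒a≡b a b (independent _
    (trans (lincomb-− a b vs) (trans (cong (_- lincomb b vs) eq) (cancel (lincomb b vs)))))

-- Matrices as linear maps

columns : Mat → Vec V 4
columns M = tabulate λ j → tabulate λ i → entry M i j

act : Mat → V → V
act M v = lincomb v (columns M)

act-isLinear : ∀ M → IsLinear (act M)
act-isLinear M = lincomb-isLinear (columns M)

lookup-lincomb : ∀ {m} (a : Vec F3 m) vs i →
                 lookup (lincomb a vs) i ≡ sumF (tabulate λ k → lookup a k *F lookup (lookup vs k) i)
lookup-lincomb []       []       i = lookup-replicate i f0
lookup-lincomb (a ∷ as) (v ∷ vs) i = begin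
  lookup (a ⊙ v + lincomb as vs) i              ≡⟨ lookup-zipWith _+F_ i (a ⊙ v) _ ⟩
  lookup (a ⊙ v) i +F lookup (lincomb as vs) i  ≡⟨ cong₂ _+F_ (lookup-zipWith _*F_ i (replicate 4 a) v)
                                                               (lookup-lincomb as vs i) ⟩
  (lookup (replicate 4 a) i *F lookup v i) +F _ ≡⟨ cong (λ x → (x *F lookup v i) +F _) (lookup-replicate i a) ⟩
  (a *F lookup v i) +F _                        ∎
  where open ≡-Reasoning

act-entry : ∀ M v i → lookup (act M v) i ≡ sumF (tabulate λ k → entry M i k *F lookup v k)
act-entry M v i = trans (lookup-lincomb v (columns M) i) (cong sumF (tabulate-cong λ k →
  trans (cong (lookup v k *F_) (entry-of-columns k)) (*F-comm (lookup v k) (entry M i k))))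
  where
  entry-of-columns : ∀ k → lookup (lookup (columns M) k) i ≡ entry M i k
  entry-of-columns k = trans (cong (λ c → lookup c i) (lookup∘tabulate (λ j → tabulate λ i → entry M i j) k))
                             (lookup∘tabulate (λ i → entry M i k) i)

entry-· : ∀ M N i j → entry (M · N) i j ≡ sumF (tabulate λ k → entry M i k *F entry N k j)
entry-· M N i j = trans (cong (λ r → lookup r j) (lookup∘tabulate (λ i → tabulate (product i)) i))
                        (lookup∘tabulate (product i) j)
  where
  product : Fin 4 → Fin 4 → F3
  product i j = sumF (tabulate λ k → entry M i k *F entry N k j)

columns-· : ∀ M N → columns (M · N) ≡ map (act M) (columns N)
columns-· M N = trans (tabulate-cong column-·) (tabulate-∘ (act M) column)
  where
  column : Fin 4 → V
  column j = tabulate λ k → entry N k j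
  column-· : ∀ j → tabulate (λ i → entry (M · N) i j) ≡ act M (column j)
  column-· j = trans (tabulate-cong λ i → trans (entry-· M N i j) (sym (trans (act-entry M (column j) i)
                 (cong sumF (tabulate-cong λ k → cong (entry M i k *F_) (lookup∘tabulate (λ k → entry N k j) k))))))
                 (tabulate∘lookup (act M (column j)))

act-· : ∀ M N v → act (M · N) v ≡ act M (act N v)
act-· M N v = begin
  lincomb v (columns (M · N))         ≡⟨ cong (lincomb v) (columns-· M N) ⟩
  lincomb v (map (act M) (columns N)) ≡⟨ IsLinear.lincomb-homo (act-isLinear M) v (columns N) ⟨
  act M (act N v)                     ∎
  where open ≡-Reasoning

act-e : ∀ M i j → lookup (act M (e j)) i ≡ entry M i j
act-e M i j = trans (cong (λ c → lookup c i) (trans (lincomb-e j (columns M))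
                                                    (lookup∘tabulate (λ j → tabulate λ i → entry M i j) j)))
                    (lookup∘tabulate (λ i → entry M i j) i)

basis-ext : ∀ M N → (∀ j → act M (e j) ≡ act N (e j)) → M ≡ N
basis-ext M N same = Pointwise-≡⇒≡ (ext λ i → Pointwise-≡⇒≡ (ext λ j →
  trans (sym (act-e M i j)) (trans (cong (λ c → lookup c i) (same j)) (act-e N i j))))

separating-vector : ∀ M N → M ≢ N → ∃ λ v → act M v ≢ act N v
separating-vector M N M≢N = Product.map e id
  (¬∀⟶∃¬ 4 (λ j → act M (e j) ≡ act N (e j)) (λ j → act M (e j) ≟V act N (e j)) (M≢N ∘ basis-ext M N))

basis : Vec V 4
basis = tabulate e

basis-expansion : ∀ v → lincomb v basis ≡ v
basis-expansion (x ∷ y ∷ z ∷ w ∷ [])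
  rewrite *F-identityʳ x | *F-identityʳ y | *F-identityʳ z | *F-identityʳ w
        | *F-zeroʳ x | *F-zeroʳ y | *F-zeroʳ z | *F-zeroʳ w
        | +F-identityʳ x | +F-identityʳ y | +F-identityʳ z | +F-identityʳ w = refl

act-idMat : ∀ v → act idMat v ≡ v
act-idMat = basis-expansion

−I : Mat
−I = map (map -F_) idMat

act-−I : ∀ v → act −I v ≡ - v
act-−I v = trans (lincomb-neg v basis) (cong -_ (basis-expansion v))

_≟M_ : DecidableEquality Mat
_≟M_ = ≡-dec _≟V_

idempotent⇒act≗id : ∀ M → M ≡ M · M → Invertible M → ∀ v → act M v ≡ v
idempotent⇒act≗id M M≡MM (N , MN≡I , _) v = begin
  act M v                 ≡⟨ cong (act M) (trans (cong (λ P → act P v) MN≡I) (act-idMat v)) ⟨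
  act M (act (M · N) v)   ≡⟨ cong (act M) (act-· M N v) ⟩
  act M (act M (act N v)) ≡⟨ act-· M M (act N v) ⟨
  act (M · M) (act N v)   ≡⟨ cong (λ P → act P (act N v)) M≡MM ⟨
  act M (act N v)         ≡⟨ act-· M N v ⟨
  act (M · N) v           ≡⟨ cong (λ P → act P v) MN≡I ⟩
  act idMat v             ≡⟨ act-idMat v ⟩
  v                       ∎
  where open ≡-Reasoning

-- The field F₃[t]/(Φ₅)

-- A vector a represents a₀ + a₁t + a₂t² + a₃t³ modulo Φ₅ = 1 + t + t² + t³ + t⁴,
-- and mulT is multiplication by t.
mulT : V → V
mulT (a₀ ∷ a₁ ∷ a₂ ∷ a₃ ∷ []) = -F a₃ ∷ (a₀ +F (-F a₃)) ∷ (a₁ +F (-F a₃)) ∷ (a₂ +F (-F a₃)) ∷ []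

infixl 7 _⋆_
_⋆_ : V → V → V
k ⋆ a = lincomb k (iterate mulT a 4)

vectors : ∀ n → List (Vec F3 n)
vectors ℕ.zero    = [] ∷ []
vectors (ℕ.suc n) = cartesianProductWith _∷_ (f0 ∷ f1 ∷ f2 ∷ []) (vectors n)

∈-vectors : ∀ {n} (v : Vec F3 n) → v ∈ vectors n
∈-vectors []      = here refl
∈-vectors (x ∷ v) = ∈-cartesianProductWith⁺ _∷_ (∈-F3 x) (∈-vectors v)
  where
  ∈-F3 : ∀ x → x ∈ f0 ∷ f1 ∷ f2 ∷ []
  ∈-F3 f0 = here refl
  ∈-F3 f1 = there (here refl)
  ∈-F3 f2 = there (there (here refl))

-- Φ₅ is irreducible over F₃, checked by exhaustive search for inverses. The search is opaque
-- so that its proof term is never unfolded during later conversion checks.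
opaque
  ⋆-invertible : All (λ a → a ≡ 0# ⊎ Any (λ k → k ⋆ a ≡ e zero) (vectors 4)) (vectors 4)
  ⋆-invertible = toWitness {a? = All.all? (λ a → (a ≟V 0#) ⊎-dec Any.any? (λ k → k ⋆ a ≟V e zero) (vectors 4))
                                          (vectors 4)} _

⋆-inverse : ∀ a → a ≢ 0# → ∃ λ k → k ⋆ a ≡ e zero
⋆-inverse a a≢0 = [ flip contradiction a≢0 , Any.satisfied ]′ (All.lookup ⋆-invertible (∈-vectors a))

-- Elements of order five in GL₄(F₃)

module OrderFive (G : V → V) (G-linear : IsLinear G) (G⁵≗id : ∀ v → G (G (G (G (G v)))) ≡ v) where
  open IsLinear G-linear

  orbit : V → Vec V 4
  orbit y = iterate G y 4

  Δ : V → V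
  Δ x = G x - x

  G⁴Δ≡-orbitSum : ∀ x → let y = Δ x in G (G (G (G y))) ≡ - (y + (G y + (G (G y) + G (G (G y)))))
  G⁴Δ≡-orbitSum x = begin
    G (G (G (G (Δ x))))
      ≡⟨ trans (cong G d₃) (−-homo x₄ x₃) ⟩
    G x₄ - x₄
      ≡⟨ cong (_- x₄) (G⁵≗id x) ⟩
    x - x₄
      ≡⟨ telescope x x₁ x₂ x₃ x₄ ⟩
    - ((x₁ - x) + ((x₂ - x₁) + ((x₃ - x₂) + (x₄ - x₃))))
      ≡⟨ cong -_ (cong (Δ x +_) (cong₂ _+_ d₁ (cong₂ _+_ d₂ d₃))) ⟨
    - (Δ x + (G (Δ x) + (G (G (Δ x)) + G (G (G (Δ x))))))
      ∎
    where
    open ≡-Reasoning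
    x₁ x₂ x₃ x₄ : V
    x₁ = G x
    x₂ = G x₁
    x₃ = G x₂
    x₄ = G x₃
    d₁ : G (Δ x) ≡ x₂ - x₁
    d₁ = −-homo x₁ x
    d₂ : G (G (Δ x)) ≡ x₃ - x₂
    d₂ = trans (cong G d₁) (−-homo x₂ x₁)
    d₃ : G (G (G (Δ x))) ≡ x₄ - x₃
    d₃ = trans (cong G d₂) (−-homo x₃ x₂)
    telescope : ∀ x₀ x₁ x₂ x₃ x₄ → x₀ - x₄ ≡ - ((x₁ - x₀) + ((x₂ - x₁) + ((x₃ - x₂) + (x₄ - x₃))))
    telescope = solve-∀ V-ring

  G-lincomb-orbit : ∀ x a → G (lincomb a (orbit (Δ x))) ≡ lincomb (mulT a) (orbit (Δ x))
  G-lincomb-orbit x a@(a₀ ∷ a₁ ∷ a₂ ∷ a₃ ∷ []) = begin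
    G (lincomb a (orbit y))
      ≡⟨ lincomb-homo a (orbit y) ⟩
    lincomb a (y₁ ∷ y₂ ∷ y₃ ∷ G y₃ ∷ [])
      ≡⟨ cong (λ z → lincomb a (y₁ ∷ y₂ ∷ y₃ ∷ z ∷ [])) (G⁴Δ≡-orbitSum x) ⟩
    lincomb a (y₁ ∷ y₂ ∷ y₃ ∷ - (y + (y₁ + (y₂ + y₃))) ∷ [])
      ≡⟨ shift (replicate 4 a₀) (replicate 4 a₁) (replicate 4 a₂) (replicate 4 a₃) y y₁ y₂ y₃ ⟩
    lincomb (mulT a) (orbit y)
      ∎
    where
    open ≡-Reasoning
    y y₁ y₂ y₃ : V
    y  = Δ x
    y₁ = G y
    y₂ = G y₁
    y₃ = G y₂
    shift : ∀ A₀ A₁ A₂ A₃ y₀ y₁ y₂ y₃ →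
            A₀ * y₁ + (A₁ * y₂ + (A₂ * y₃ + (A₃ * (- (y₀ + (y₁ + (y₂ + y₃)))) + 0#))) ≡
            (- A₃) * y₀ + ((A₀ - A₃) * y₁ + ((A₁ - A₃) * y₂ + ((A₂ - A₃) * y₃ + 0#)))
    shift = solve-∀ V-ring

  orbit-dependent⇒Δ≡0 : ∀ x a → lincomb a (orbit (Δ x)) ≡ 0# → a ≢ 0# → Δ x ≡ 0#
  orbit-dependent⇒Δ≡0 x a Ra≡0 a≢0 = begin
    Δ x                                  ≡⟨ lincomb-e zero (orbit (Δ x)) ⟨
    R (e zero)                           ≡⟨ cong R (proj₂ (⋆-inverse a a≢0)) ⟨
    R (k ⋆ a)                            ≡⟨ R.lincomb-homo k (iterate mulT a 4) ⟩
    lincomb k (map R (iterate mulT a 4)) ≡⟨ cong (lincomb k) (powers-in-kernel 4 a Ra≡0) ⟩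
    lincomb k (replicate 4 0#)           ≡⟨ lincomb-zeroʳ k ⟩
    0#                                   ∎
    where
    open ≡-Reasoning
    R : V → V
    R b = lincomb b (orbit (Δ x))
    module R = IsLinear (lincomb-isLinear (orbit (Δ x)))
    k : V
    k = proj₁ (⋆-inverse a a≢0)
    powers-in-kernel : ∀ n b → R b ≡ 0# → map R (iterate mulT b n) ≡ replicate n 0#
    powers-in-kernel ℕ.zero    b Rb≡0 = refl
    powers-in-kernel (ℕ.suc n) b Rb≡0 = cong₂ _∷_ Rb≡0 (powers-in-kernel n (mulT b)
      (trans (sym (G-lincomb-orbit x b)) (trans (cong G Rb≡0) 0#-homo)))

  module _ (Z : V → V) (Z-linear : IsLinear Z) (ZG≗GZ : ∀ v → Z (G v) ≡ G (Z v)) where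
    private
      module Z = IsLinear Z-linear

    Z-fixes-orbit : ∀ {v} → Z v ≡ v → ∀ n → map Z (iterate G v n) ≡ iterate G v n
    Z-fixes-orbit Zv≡v ℕ.zero    = refl
    Z-fixes-orbit Zv≡v (ℕ.suc n) = cong₂ _∷_ Zv≡v (Z-fixes-orbit (trans (ZG≗GZ _) (cong G Zv≡v)) n)

    Z-fixes-Δ : ∀ {x} → Z x ≡ x → Z (Δ x) ≡ Δ x
    Z-fixes-Δ {x} Zx≡x = trans (Z.−-homo (G x) x) (cong₂ _-_ (trans (ZG≗GZ x) (cong G Zx≡x)) Zx≡x)

    orbit∷ʳw-independent : ∀ {x w} → Z x ≡ x → Z w ≡ - w → w ≢ 0# → Δ x ≢ 0# →
                           LinearlyIndependent (orbit (Δ x) ∷ʳ w)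
    orbit∷ʳw-independent {x} {w} Zx≡x Zw≡-w w≢0 Δx≢0 (a₀ ∷ a₁ ∷ a₂ ∷ a₃ ∷ c ∷ []) combination≡0 =
      cong₂ _∷ʳ_ a≡0 c≡0
      where
      open ≡-Reasoning
      a A B : V
      a = a₀ ∷ a₁ ∷ a₂ ∷ a₃ ∷ []
      A = lincomb a (orbit (Δ x))
      B = c ⊙ w
      A+B≡0 : A + B ≡ 0#
      A+B≡0 = trans (sym (lincomb-∷ʳ a c (orbit (Δ x)) w)) combination≡0
      ZA≡A : Z A ≡ A
      ZA≡A = trans (Z.lincomb-homo a (orbit (Δ x))) (cong (lincomb a) (Z-fixes-orbit (Z-fixes-Δ Zx≡x) 4))
      ZB≡-B : Z B ≡ - B
      ZB≡-B = trans (Z.⊙-homo c w) (trans (cong (c ⊙_) Zw≡-w) (*-neg (replicate 4 c) w))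
        where
        *-neg : ∀ C w → C * (- w) ≡ - (C * w)
        *-neg = solve-∀ V-ring
      A-B≡0 : A - B ≡ 0#
      A-B≡0 = begin
        A - B      ≡⟨ cong₂ _+_ ZA≡A ZB≡-B ⟨
        Z A + Z B  ≡⟨ Z.+-homo A B ⟨
        Z (A + B)  ≡⟨ cong Z A+B≡0 ⟩
        Z 0#       ≡⟨ Z.0#-homo ⟩
        0#         ∎
      B≡0 : B ≡ 0#
      B≡0 = trans (cancel-A A B) (cong₂ _-_ A-B≡0 A+B≡0)
        where
        cancel-A : ∀ A B → B ≡ (A - B) - (A + B)
        cancel-A = solve-∀ V-ring
      c≡0 : c ≡ f0
      c≡0 = [ id , flip contradiction w≢0 ]′ (c⊙w≡0⇒c≡0⊎w≡0 c w B≡0)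
      A≡0 : A ≡ 0#
      A≡0 = trans (cancel-B A B) (cong₂ _-_ A+B≡0 B≡0)
        where
        cancel-B : ∀ A B → A ≡ (A + B) - B
        cancel-B = solve-∀ V-ring
      a≡0 : a ≡ 0#
      a≡0 = decidable-stable (a ≟V 0#) λ a≢0 → Δx≢0 (orbit-dependent⇒Δ≡0 x a A≡0 a≢0)

    fixed⇒G-fixed : ∀ {x w} → Z x ≡ x → Z w ≡ - w → w ≢ 0# → G x ≡ x
    fixed⇒G-fixed {x} Zx≡x Zw≡-w w≢0 = a-b≡0⇒a≡b (G x) x (decidable-stable (Δ x ≟V 0#) λ Δx≢0 →
      ℕ.1+n≰n (independent⇒length≤4 (orbit∷ʳw-independent Zx≡x Zw≡-w w≢0 Δx≢0)))

  non-scalar-involution⇒G≗id : ∀ Z → IsLinear Z → (∀ v → Z (Z v) ≡ v) → (∀ v → Z (G v) ≡ G (Z v)) →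
                               ∀ {u u′} → Z u ≢ u → Z u′ ≢ - u′ → ∀ v → G v ≡ v
  non-scalar-involution⇒G≗id Z Z-linear Z²≗id ZG≗GZ {u} {u′} Zu≢u Zu′≢-u′ v = begin
    G v                            ≡⟨ cong G (decompose v (Z v)) ⟩
    G (- ((v + Z v) + (v - Z v)))  ≡⟨ -‿homo _ ⟩
    - G ((v + Z v) + (v - Z v))    ≡⟨ cong -_ (+-homo _ _) ⟩
    - (G (v + Z v) + G (v - Z v))  ≡⟨ cong -_ (cong₂ _+_ G-fixes-v₊ G-fixes-v₋) ⟩
    - ((v + Z v) + (v - Z v))      ≡⟨ decompose v (Z v) ⟨
    v                              ∎
    where
    open ≡-Reasoning
    module Z = IsLinear Z-linear
    -- in characteristic 3, −2 = 1
    decompose : ∀ v z → v ≡ - ((v + z) + (v - z))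
    decompose = solve-∀ V-ring
    Z-fixes-sum : ∀ v → Z (v + Z v) ≡ v + Z v
    Z-fixes-sum v = trans (Z.+-homo v (Z v)) (trans (cong (Z v +_) (Z²≗id v)) (+-comm (Z v) v))
      where
      +-comm : ∀ x y → x + y ≡ y + x
      +-comm = solve-∀ V-ring
    Z-negates-difference : ∀ v → Z (v - Z v) ≡ - (v - Z v)
    Z-negates-difference v = trans (Z.−-homo v (Z v)) (trans (cong (λ z → Z v - z) (Z²≗id v)) (antisym (Z v) v))
      where
      antisym : ∀ x y → x - y ≡ - (y - x)
      antisym = solve-∀ V-ring
    G-fixes-v₊ : G (v + Z v) ≡ v + Z v
    G-fixes-v₊ = fixed⇒G-fixed Z Z-linear ZG≗GZ (Z-fixes-sum v) (Z-negates-difference u)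
      λ u-Zu≡0 → Zu≢u (sym (a-b≡0⇒a≡b u (Z u) u-Zu≡0))
    -- the (−1)-eigenspace of Z is the fixed space of −Z
    G-fixes-v₋ : G (v - Z v) ≡ v - Z v
    G-fixes-v₋ = fixed⇒G-fixed (λ v → - Z v) (-‿isLinear Z-linear)
      (λ v → trans (cong -_ (ZG≗GZ v)) (sym (-‿homo (Z v))))
      (trans (cong -_ (Z-negates-difference v)) (-‿involutive (v - Z v))) (cong -_ (Z-fixes-sum u′))
      λ u′+Zu′≡0 → Zu′≢-u′ (trans (cancel u′ (Z u′)) (trans (cong (_- u′) u′+Zu′≡0) (zero-minus u′)))
      where
      -‿involutive : ∀ x → - (- x) ≡ x
      -‿involutive = solve-∀ V-ring
      cancel : ∀ x y → y ≡ (x + y) - x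
      cancel = solve-∀ V-ring
      zero-minus : ∀ x → 0# - x ≡ - x
      zero-minus = solve-∀ V-ring

-- The embedding

inA5? : ∀ σ → Dec (InA5 σ)
inA5? σ = (all? λ i → all? λ j → (lookup σ i Fin.≟ lookup σ j) →-dec (i Fin.≟ j))
   ×-dec (inversions σ % 2 ℕ.≟ 0)

ι cycle : Perm5
ι     = allFin 5
cycle = suc zero ∷ suc (suc zero) ∷ suc (suc (suc zero)) ∷ suc (suc (suc (suc zero))) ∷ zero ∷ []

cycle² cycle³ cycle⁴ : Perm5
cycle² = cycle ∘p cycle
cycle³ = cycle ∘p cycle²
cycle⁴ = cycle ∘p cycle³

ι∈A5 : InA5 ι
ι∈A5 = from-yes (inA5? ι)

cycle∈A5 : InA5 cycle
cycle∈A5 = from-yes (inA5? cycle)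

cycle≢ι : cycle ≢ ι
cycle≢ι ()

module _ (E : EmbedsA5×V4) where
  open EmbedsA5×V4 E

  act-hom : ∀ {σ τ} a b c d → InA5 σ → InA5 τ → ∀ v →
            act (φ (σ ∘p τ) (a xor c) (b xor d)) v ≡ act (φ σ a b) (act (φ τ c d) v)
  act-hom {σ} {τ} a b c d σ∈A5 τ∈A5 v =
    trans (cong (λ M → act M v) (hom σ τ a b c d σ∈A5 τ∈A5)) (act-· (φ σ a b) (φ τ c d) v)

  act-φι : ∀ v → act (φ ι false false) v ≡ v
  act-φι = idempotent⇒act≗id (φ ι false false)
    (hom ι ι false false false false ι∈A5 ι∈A5) (inGL ι false false ι∈A5)

  faithful : ∀ {σ a b} → InA5 σ → (∀ v → act (φ σ a b) v ≡ v) → σ ≡ ι × a ≡ false × b ≡ false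
  faithful {σ} {a} {b} σ∈A5 trivial = inj σ ι a b false false σ∈A5 ι∈A5
    (basis-ext (φ σ a b) (φ ι false false) λ j → trans (trivial (e j)) (sym (act-φι (e j))))

  G : V → V
  G = act (φ cycle false false)

  G⁵≗id : ∀ v → G (G (G (G (G v)))) ≡ v
  G⁵≗id v = begin
    G (G (G (G (G v))))                      ≡⟨ cong G (cong G (cong G (G-act cycle∈A5 v))) ⟩
    G (G (G (act (φ cycle² false false) v))) ≡⟨ cong G (cong G (G-act (from-yes (inA5? cycle²)) v)) ⟩
    G (G (act (φ cycle³ false false) v))     ≡⟨ cong G (G-act (from-yes (inA5? cycle³)) v) ⟩
    G (act (φ cycle⁴ false false) v)         ≡⟨ G-act (from-yes (inA5? cycle⁴)) v ⟩
    act (φ ι false false) v                  ≡⟨ act-φι v ⟩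
    v                                        ∎
    where
    open ≡-Reasoning
    G-act : ∀ {τ} → InA5 τ → ∀ v → G (act (φ τ false false) v) ≡ act (φ (cycle ∘p τ) false false) v
    G-act τ∈A5 v = sym (act-hom false false false false cycle∈A5 τ∈A5 v)

  Z : Bool → Bool → V → V
  Z a b = act (φ ι a b)

  Z²≗id : ∀ a b v → Z a b (Z a b v) ≡ v
  Z²≗id a b v = begin
    Z a b (Z a b v)                 ≡⟨ act-hom a b a b ι∈A5 ι∈A5 v ⟨
    act (φ ι (a xor a) (b xor b)) v ≡⟨ cong₂ (λ a b → act (φ ι a b) v) (xor-same a) (xor-same b) ⟩
    act (φ ι false false) v         ≡⟨ act-φι v ⟩
    v                               ∎
    where open ≡-Reasoning

  ZG≗GZ : ∀ a b v → Z a b (G v) ≡ G (Z a b v)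
  ZG≗GZ a b v = begin
    Z a b (G v)                                 ≡⟨ act-hom a b false false ι∈A5 cycle∈A5 v ⟨
    act (φ cycle (a xor false) (b xor false)) v ≡⟨ cong₂ (λ a b → act (φ cycle a b) v)
                                                           (xor-identityʳ a) (xor-identityʳ b) ⟩
    act (φ cycle a b) v                         ≡⟨ act-hom false false a b cycle∈A5 ι∈A5 v ⟩
    G (Z a b v)                                 ∎
    where open ≡-Reasoning

  V₄-image : ∀ a b → ¬ (a ≡ false × b ≡ false) → φ ι a b ≡ −I
  V₄-image a b nontrivial = decidable-stable (φ ι a b ≟M −I) λ z≢−I →
    let u  , Zu≢u    = separating-vector z idMat z≢I
        u′ , Zu′≢-u′ = separating-vector z −I z≢−I
    in cycle≢ι (proj₁ (faithful cycle∈A5 (G≗id u u′ Zu≢u Zu′≢-u′)))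
    where
    z : Mat
    z = φ ι a b
    z≢I : z ≢ idMat
    z≢I z≡I = nontrivial (proj₂ (faithful ι∈A5 λ v → trans (cong (λ M → act M v) z≡I) (act-idMat v)))
    G≗id : ∀ u u′ → act z u ≢ act idMat u → act z u′ ≢ act −I u′ → ∀ v → G v ≡ v
    G≗id u u′ Zu≢u Zu′≢-u′ = OrderFive.non-scalar-involution⇒G≗id
      G (act-isLinear (φ cycle false false)) G⁵≗id (Z a b) (act-isLinear z) (Z²≗id a b) (ZG≗GZ a b)
      (λ Zu≡u → Zu≢u (trans Zu≡u (sym (act-idMat u))))
      (λ Zu′≡-u′ → Zu′≢-u′ (trans Zu′≡-u′ (sym (act-−I u′))))

lemma3p15 : ¬ EmbedsA5×V4
lemma3p15 E = true≢false (proj₁ (proj₂ (inj ι ι true false false true ι∈A5 ι∈A5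
  (trans (V₄-image E true false λ ()) (sym (V₄-image E false true λ ()))))))
  where
  open EmbedsA5×V4 E using (inj)
  true≢false : true ≢ false
  true≢false ()
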